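{- Let $S$ be a string with $n=\mathit{size}(\mathit{RLE}_S)$, and write $rs(h)=\mathit{RLE\_SA}_S[h]$. Let $i,j$ be integers with $1\le i<j\le n$. Then: (1) for any $j'$ with $j<j'\le n$, $|\mathit{lcp}(\mathit{RLE}_S[rs(i)..n],\mathit{RLE}_S[rs(j)..n])|\ge|\mathit{lcp}(\mathit{RLE}_S[rs(i)..n],\mathit{RLE}_S[rs(j')..n])|$; (2) for any $i'$ with $1\le i'<i$, $|\mathit{lcp}(\mathit{RLE}_S[rs(i)..n],\mathit{RLE}_S[rs(j)..n])|\ge|\mathit{lcp}(\mathit{RLE}_S[rs(i')..n],\mathit{RLE}_S[rs(j)..n])|$.
   Context: $\Sigma$ is a totally ordered alphabet. $\mathit{RLE}_S=a_1^{p_1}\cdots a_n^{p_n}$ is the run-length encoding of $S$ ($S=a_1^{p_1}\cdots a_n^{p_n}$, $p_i\ge1$, $a_i\ne a_{i+1}$, $a^p$ = $p$ copies of $a$), $n=\mathit{size}(\mathit{RLE}_S)$, and $\mathit{RLE}_S[i..j]=a_i^{p_i}\cdots a_j^{p_j}$. RL factors are compared by $a^p\prec b^r$ iff $a<b$, or $a=b$ and $p<r$; $\mathit{RLE\_SA}_S[i]=j$ iff $\mathit{RLE}_S[j..n]$ is the $i$-th smallest of the sequences $\mathit{RLE}_S[1..n],\ldots,\mathit{RLE}_S[n..n]$ in the lexicographic order over RL factors w.r.t. $\prec$. For run-length encoded strings $R_X,R_Y$ decoding to strings $X,Y$, $\mathit{lcp}(R_X,R_Y)$ denotes the longest common prefix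 of the decoded strings $X$ and $Y$, and $|\cdot|$ its length. -}

module Defs where

open import Level using (Level; _⊔_)
open import Data.Nat using (ℕ; zero; suc; _≤_)
import Data.Nat as ℕ
open import Data.Fin using (Fin; toℕ)
import Data.Fin as Fin
open import Data.List using (List; []; _∷_; length; drop; replicate; _++_)
open import Data.Product using (_×_; _,_; Σ)
open import Data.Sum using (_⊎_)
open import Relation.Nullary using (yes; no)
open import Relation.Binary using (Rel; DecidableEquality)
open import Relation.Binary.PropositionalEquality using (_≡_)
open import Data.List.Relation.Binary.Lex.Core using (Lex-<)
open import Function.Definitions using (Bijective)

private variable a ℓ : Level

-- An RL factor a^p is represented by the pair (a , p), p ≥ 1.
Run : Set a → Set a
Run A = A × ℕ

module _ {A : Set a} (_≟_ : DecidableEquality A) where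

  consRun : A → List (Run A) → List (Run A)
  consRun x [] = (x , 1) ∷ []
  consRun x ((y , k) ∷ r) with x ≟ y
  ... | yes _ = (y , suc k) ∷ r
  ... | no _  = (x , 1) ∷ (y , k) ∷ r

  -- RLE_S : maximal runs, adjacent letters distinct, exponents ≥ 1
  rle : List A → List (Run A)
  rle [] = []
  rle (x ∷ xs) = consRun x (rle xs)

  lcpLen : List A → List A → ℕ
  lcpLen [] _ = 0
  lcpLen (_ ∷ _) [] = 0
  lcpLen (x ∷ xs) (y ∷ ys) with x ≟ y
  ... | yes _ = suc (lcpLen xs ys)
  ... | no _  = 0

decode : {A : Set a} → List (Run A) → List A
decode [] = []
decode ((x , p) ∷ r) = replicate p x ++ decode r

_≺[_]_ : {A : Set a} → Run A → Rel A ℓ → Run A → Set (a ⊔ ℓ)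
(x , p) ≺[ _<_ ] (y , r) = (x < y) ⊎ ((x ≡ y) × (p ℕ.< r))

module _ {A : Set a} (_≟_ : DecidableEquality A) (_<_ : Rel A ℓ) (S : List A) where

  size : ℕ
  size = length (rle _≟_ S)

  -- RLE_S[j..n] for the 0-based index j (paper index j+1)
  suffix : Fin size → List (Run A)
  suffix j = drop (toℕ j) (rle _≟_ S)

  -- rs is RLE_SA_S (0-based): a permutation of the suffix start positions
  -- such that rs i is the start of the i-th smallest suffix in the
  -- lexicographic order over RL factors w.r.t. ≺.
  IsRLE-SA : (Fin size → Fin size) → Set (a ⊔ ℓ)
  IsRLE-SA rs = Bijective _≡_ _≡_ rs
              × (∀ i j → i Fin.< j →
                   Lex-< _≡_ (λ u v → u ≺[ _<_ ] v) (suffix (rs i)) (suffix (rs j)))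

  lcpSuf : Fin size → Fin size → ℕ
  lcpSuf p q = lcpLen _≟_ (decode (suffix p)) (decode (suffix q))

-- For suffixes X < Y < Z in the RL order, lcp(X, Z) ≤ min(lcp(X, Y), lcp(Y, Z)),
-- from which both claims follow. Comparing canonical encodings run by run, the
-- first differing runs either carry different letters, and the decoded lcp stops
-- there, or the same letter with different exponents, and it stops after the
-- shorter run because the next letter differs. Since a sandwich of runs
-- (x,p) ≺ (y,r) ≺ (x,s) forces y = x and p < r < s, the middle suffix agrees with
-- each outer one at least as far as the outer ones agree with each other.
module Submission where

open import Defs
open import Level using (Level)
open import Data.Nat as ℕ using (ℕ; zero; suc; z≤n; s≤s; _+_; _⊓_; _≤_; _≥_)
open import Data.Nat.Properties
  using (≤-refl; ≤-trans; <-trans; <⇒≤; m≤m+n; +-monoʳ-≤; +-distribˡ-⊓; ⊓-glb; m⊓n≤m; m⊓n≤n; module ≤-Reasoning)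
open import Data.Fin using (Fin; _<_; toℕ)
open import Data.List using (List; []; _∷_; replicate; _++_; drop; head)
open import Data.List.Relation.Binary.Lex.Core using (Lex-<; this; next)
open import Data.Maybe using (just)
open import Data.Maybe.Properties using (just-injective)
open import Data.Product using (_×_; _,_)
open import Data.Sum using (inj₁; inj₂)
open import Relation.Nullary using (yes; no; contradiction)
open import Relation.Binary using (Rel; DecidableEquality; IsStrictPartialOrder; IsStrictTotalOrder)
open import Relation.Binary.PropositionalEquality using (_≡_; _≢_; refl; sym; cong; cong₂)

private variable
  a ℓ : Level

-- The paper's condition a_i ≠ a_{i+1} is phrased on the decoded rest, which
-- together with p ≥ 1 is equivalent to it.
data Canonical {A : Set a} : List (Run A) → Set a where
  []   : Canonical []
  cons : ∀ {x p r} → 1 ≤ p → head (decode r) ≢ just x → Canonical r →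
         Canonical ((x , p) ∷ r)

drop-canonical : ∀ {A : Set a} k {r : List (Run A)} → Canonical r → Canonical (drop k r)
drop-canonical zero    c            = c
drop-canonical (suc k) []           = []
drop-canonical (suc k) (cons _ _ c) = drop-canonical k c

module _ {A : Set a} (_≟_ : DecidableEquality A) where

  consRun-canonical : ∀ x {r} → Canonical r → Canonical (consRun _≟_ x r)
  consRun-canonical x [] = cons (s≤s z≤n) (λ ()) []
  consRun-canonical x {(y , suc k) ∷ r} c@(cons _ y∉r cr) with x ≟ y
  ... | yes refl = cons (s≤s z≤n) y∉r cr
  ... | no x≢y   = cons (s≤s z≤n) (λ y≡x → x≢y (sym (just-injective y≡x))) c

  rle-canonical : ∀ S → Canonical (rle _≟_ S)
  rle-canonical []       = []
  rle-canonical (x ∷ xs) = consRun-canonical x (rle-canonical xs)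

  lcpLen-replicate-++ : ∀ p x U V →
    lcpLen _≟_ (replicate p x ++ U) (replicate p x ++ V) ≡ p + lcpLen _≟_ U V
  lcpLen-replicate-++ zero    x U V = refl
  lcpLen-replicate-++ (suc p) x U V with x ≟ x
  ... | yes _   = cong suc (lcpLen-replicate-++ p x U V)
  ... | no x≢x = contradiction refl x≢x

  lcpLen-replicate-< : ∀ {p r} x U V → head U ≢ just x → p ℕ.< r →
    lcpLen _≟_ (replicate p x ++ U) (replicate r x ++ V) ≡ p
  lcpLen-replicate-< {zero}  x []      V x∉U _ = refl
  lcpLen-replicate-< {zero} {suc r} x (c ∷ U) V x∉U _ with c ≟ x
  ... | yes refl = contradiction refl x∉U
  ... | no _     = refl
  lcpLen-replicate-< {suc p} {suc r} x U V x∉U (s≤s p<r) with x ≟ x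
  ... | yes _   = cong suc (lcpLen-replicate-< x U V x∉U p<r)
  ... | no x≢x = contradiction refl x≢x

  lcpRLE : List (Run A) → List (Run A) → ℕ
  lcpRLE X Y = lcpLen _≟_ (decode X) (decode Y)

  lcpRLE-≡ : ∀ x p X Y → lcpRLE ((x , p) ∷ X) ((x , p) ∷ Y) ≡ p + lcpRLE X Y
  lcpRLE-≡ x p X Y = lcpLen-replicate-++ p x (decode X) (decode Y)

  lcpRLE-< : ∀ {x p r X} Y → Canonical ((x , p) ∷ X) → p ℕ.< r →
             lcpRLE ((x , p) ∷ X) ((x , r) ∷ Y) ≡ p
  lcpRLE-< {x} {X = X} Y (cons _ x∉X _) = lcpLen-replicate-< x (decode X) (decode Y) x∉X

  lcpRLE-≢ : ∀ {x p y r X Y} → Canonical ((x , p) ∷ X) → Canonical ((y , r) ∷ Y) → x ≢ y →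
             lcpRLE ((x , p) ∷ X) ((y , r) ∷ Y) ≡ 0
  lcpRLE-≢ {x} {y = y} (cons (s≤s _) _ _) (cons (s≤s _) _ _) x≢y with x ≟ y
  ... | yes x≡y = contradiction x≡y x≢y
  ... | no _    = refl

module _ {A : Set a} {_≺_ : Rel A ℓ} (≺-spo : IsStrictPartialOrder _≡_ _≺_) where
  open IsStrictPartialOrder ≺-spo using (irrefl; trans)

  ≺-run⇒< : ∀ {x p r} → (x , p) ≺[ _≺_ ] (x , r) → p ℕ.< r
  ≺-run⇒< (inj₁ x≺x)        = contradiction x≺x (irrefl refl)
  ≺-run⇒< (inj₂ (_ , p<r)) = p<r

  ≺-run-sandwich : ∀ {x p y r s} → (x , p) ≺[ _≺_ ] (y , r) → (y , r) ≺[ _≺_ ] (x , s) → x ≡ y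
  ≺-run-sandwich (inj₂ (x≡y , _))  _                 = x≡y
  ≺-run-sandwich (inj₁ x≺y)        (inj₁ y≺x)        = contradiction (trans x≺y y≺x) (irrefl refl)
  ≺-run-sandwich (inj₁ x≺y)        (inj₂ (refl , _)) = contradiction x≺y (irrefl refl)

module _ {A : Set a} (_≟_ : DecidableEquality A) {_≺_ : Rel A ℓ}
         (≺-spo : IsStrictPartialOrder _≡_ _≺_) where

  private
    _<ˡ_ : Rel (List (Run A)) _
    _<ˡ_ = Lex-< _≡_ (λ u v → u ≺[ _≺_ ] v)

    lcp : List (Run A) → List (Run A) → ℕ
    lcp = lcpRLE _≟_

  open ≤-Reasoning

  lcpRLE-sandwich : ∀ {X Y Z} → Canonical X → Canonical Y → Canonical Z →
                    X <ˡ Y → Y <ˡ Z → lcp X Z ≤ lcp X Y ⊓ lcp Y Z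
  lcpRLE-sandwich {[]} _ _ _ _ _ = z≤n
  lcpRLE-sandwich {(x , p) ∷ X} {(y , r) ∷ Y} {(z , s) ∷ Z} cX cY cZ (this u≺v) (this v≺w)
    with x ≟ z
  ... | no x≢z rewrite lcpRLE-≢ _≟_ cX cZ x≢z = z≤n
  ... | yes refl with ≺-run-sandwich ≺-spo u≺v v≺w
  ... | refl = begin
    lcp ((x , p) ∷ X) ((x , s) ∷ Z)  ≡⟨ lcpRLE-< _≟_ Z cX (<-trans p<r r<s) ⟩
    p                                ≤⟨ ⊓-glb ≤-refl (<⇒≤ p<r) ⟩
    p ⊓ r                            ≡⟨ cong₂ _⊓_ (lcpRLE-< _≟_ Y cX p<r) (lcpRLE-< _≟_ Z cY r<s) ⟨
    lcp ((x , p) ∷ X) ((x , r) ∷ Y) ⊓ lcp ((x , r) ∷ Y) ((x , s) ∷ Z) ∎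
    where p<r = ≺-run⇒< ≺-spo u≺v
          r<s = ≺-run⇒< ≺-spo v≺w
  lcpRLE-sandwich {(x , p) ∷ X} {(y , r) ∷ Y} {(.y , .r) ∷ Z} cX cY cZ (this u≺v) (next refl _)
    with x ≟ y
  ... | no x≢y rewrite lcpRLE-≢ _≟_ cX cZ x≢y = z≤n
  ... | yes refl = begin
    lcp ((x , p) ∷ X) ((x , r) ∷ Z)  ≡⟨ lcpRLE-< _≟_ Z cX p<r ⟩
    p                                ≤⟨ ⊓-glb ≤-refl (≤-trans (<⇒≤ p<r) (m≤m+n r _)) ⟩
    p ⊓ (r + lcp Y Z)                ≡⟨ cong₂ _⊓_ (lcpRLE-< _≟_ Y cX p<r) (lcpRLE-≡ _≟_ x r Y Z) ⟨
    lcp ((x , p) ∷ X) ((x , r) ∷ Y) ⊓ lcp ((x , r) ∷ Y) ((x , r) ∷ Z) ∎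
    where p<r = ≺-run⇒< ≺-spo u≺v
  lcpRLE-sandwich {(x , p) ∷ X} {(.x , .p) ∷ Y} {(z , s) ∷ Z} cX cY cZ (next refl _) (this v≺w)
    with x ≟ z
  ... | no x≢z rewrite lcpRLE-≢ _≟_ cX cZ x≢z = z≤n
  ... | yes refl = begin
    lcp ((x , p) ∷ X) ((x , s) ∷ Z)  ≡⟨ lcpRLE-< _≟_ Z cX p<s ⟩
    p                                ≤⟨ ⊓-glb (m≤m+n p _) ≤-refl ⟩
    (p + lcp X Y) ⊓ p                ≡⟨ cong₂ _⊓_ (lcpRLE-≡ _≟_ x p X Y) (lcpRLE-< _≟_ Z cY p<s) ⟨
    lcp ((x , p) ∷ X) ((x , p) ∷ Y) ⊓ lcp ((x , p) ∷ Y) ((x , s) ∷ Z) ∎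
    where p<s = ≺-run⇒< ≺-spo v≺w
  lcpRLE-sandwich {(x , p) ∷ X} {(.x , .p) ∷ Y} {(.x , .p) ∷ Z}
                  (cons _ _ cX) (cons _ _ cY) (cons _ _ cZ) (next refl X<Y) (next refl Y<Z) = begin
    lcp ((x , p) ∷ X) ((x , p) ∷ Z)  ≡⟨ lcpRLE-≡ _≟_ x p X Z ⟩
    p + lcp X Z                      ≤⟨ +-monoʳ-≤ p (lcpRLE-sandwich cX cY cZ X<Y Y<Z) ⟩
    p + (lcp X Y ⊓ lcp Y Z)          ≡⟨ +-distribˡ-⊓ p _ _ ⟩
    (p + lcp X Y) ⊓ (p + lcp Y Z)    ≡⟨ cong₂ _⊓_ (lcpRLE-≡ _≟_ x p X Y) (lcpRLE-≡ _≟_ x p Y Z) ⟨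
    lcp ((x , p) ∷ X) ((x , p) ∷ Y) ⊓ lcp ((x , p) ∷ Y) ((x , p) ∷ Z) ∎

module _ {A : Set a} {_≺_ : Rel A ℓ} (sto : IsStrictTotalOrder _≡_ _≺_) (S : List A) where
  open IsStrictTotalOrder sto using (_≟_; isStrictPartialOrder)

  lcpSuf-sandwich : ∀ p q r →
    Lex-< _≡_ (λ u v → u ≺[ _≺_ ] v) (suffix _≟_ _≺_ S p) (suffix _≟_ _≺_ S q) →
    Lex-< _≡_ (λ u v → u ≺[ _≺_ ] v) (suffix _≟_ _≺_ S q) (suffix _≟_ _≺_ S r) →
    lcpSuf _≟_ _≺_ S p r ≤ lcpSuf _≟_ _≺_ S p q ⊓ lcpSuf _≟_ _≺_ S q r
  lcpSuf-sandwich p q r =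
    lcpRLE-sandwich _≟_ isStrictPartialOrder (canonical p) (canonical q) (canonical r)
    where
    canonical : ∀ k → Canonical (suffix _≟_ _≺_ S k)
    canonical k = drop-canonical (toℕ k) (rle-canonical _≟_ S)

lemma3 : ∀ {a ℓ : Level} {A : Set a} {_≺_ : Rel A ℓ}
           (sto : IsStrictTotalOrder _≡_ _≺_) (S : List A)
           (rs : Fin (size (IsStrictTotalOrder._≟_ sto) _≺_ S) → Fin (size (IsStrictTotalOrder._≟_ sto) _≺_ S)) →
           IsRLE-SA (IsStrictTotalOrder._≟_ sto) _≺_ S rs →
           ∀ i j → i < j →
           (∀ j′ → j < j′ →
              lcpSuf (IsStrictTotalOrder._≟_ sto) _≺_ S (rs i) (rs j)
                ≥ lcpSuf (IsStrictTotalOrder._≟_ sto) _≺_ S (rs i) (rs j′))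
           × (∀ i′ → i′ < i →
              lcpSuf (IsStrictTotalOrder._≟_ sto) _≺_ S (rs i) (rs j)
                ≥ lcpSuf (IsStrictTotalOrder._≟_ sto) _≺_ S (rs i′) (rs j))
lemma3 sto S rs (_ , sorted) i j i<j =
    (λ j′ j<j′ → ≤-trans (lcpSuf-sandwich sto S (rs i) (rs j) (rs j′) (sorted i j i<j) (sorted j j′ j<j′))
                         (m⊓n≤m _ _))
  , (λ i′ i′<i → ≤-trans (lcpSuf-sandwich sto S (rs i′) (rs i) (rs j) (sorted i′ i i′<i) (sorted i j i<j))
                         (m⊓n≤n _ _))
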